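{- Let $n\ge 1$ be an integer and let $M=m/2^n$ where $m$ is an odd integer with $1\le m\le 2^n-1$. If $(A_0,A_1,\dots,A_n)$ is an EXB code of resolution $n$ of $M$ and $j\in\{1,\dots,n\}$ satisfies $A_j=1$, then there exists an EXB code $(B_0,B_1,\dots,B_n)$ of resolution $n$ of $M$ with $B_j=-1$.
   Context: An EXB (extended binary) code of resolution $n$ of a number $M$ is a tuple $(A_0,A_1,\dots,A_n)$ of integers with $A_0\in\{0,1\}$ and $A_j\in\{ -1,0,1\}$ for $1\le j\le n$, such that $M=A_0+\sum_{j=1}^{n}A_j2^{ -j}$. -}

module Defs where

open import Data.Nat using (ℕ; zero; suc; _^_)
open import Data.Nat.Properties using (m^n≢0)
open import Data.Fin using (Fin; toℕ)
import Data.Fin as Fin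
open import Data.Integer using (ℤ; +_; -[1+_])
open import Data.Rational using (ℚ; _+_; 0ℚ; _/_)
open import Data.Product using (_×_)
open import Data.Sum using (_⊎_)
open import Relation.Binary.PropositionalEquality using (_≡_)

Σ[<] : (n : ℕ) → (Fin n → ℚ) → ℚ
Σ[<] zero f = 0ℚ
Σ[<] (suc n) f = f Fin.zero + Σ[<] n (λ i → f (Fin.suc i))

_/2^_ : ℤ → ℕ → ℚ
a /2^ k = _/_ a (2 ^ k) {{m^n≢0 2 k}}

-- A tuple (A_0, ..., A_n) is represented as A : Fin (suc n) → ℤ,
-- where A i is A_{toℕ i}.
-- value n A = A_0 + Σ_{j=1}^{n} A_j 2^{-j}  =  Σ_{j=0}^{n} A_j / 2^j
value : (n : ℕ) → (Fin (suc n) → ℤ) → ℚ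
value n A = Σ[<] (suc n) (λ i → A i /2^ toℕ i)

IsBit : ℤ → Set
IsBit a = (a ≡ + 0) ⊎ (a ≡ + 1)

IsTrit : ℤ → Set
IsTrit a = (a ≡ -[1+ 0 ]) ⊎ ((a ≡ + 0) ⊎ (a ≡ + 1))

IsEXB : (n : ℕ) → ℚ → (Fin (suc n) → ℤ) → Set
IsEXB n M A =
  IsBit (A Fin.zero) × (∀ (j : Fin n) → IsTrit (A (Fin.suc j))) × (M ≡ value n A)

{-# OPTIONS --safe #-}
-- A digit 1 at position j becomes -1 by a carry: (a, 1) at positions j - 1, j
-- has the same value as (a + 1, -1), since 2a + 1 = 2(a + 1) - 1. This is a
-- valid recoding when a ∈ {-1, 0}. When a = 1, first recode position j - 1 to
-- -1 by the same argument and carry from there. The recursion can only get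
-- stuck at A₀ = A₁ = 1, which forces the value to be at least
-- 1 + 1/2 - Σ_{i ≥ 2} 2^{-i} ≥ 1, impossible for M = m / 2ⁿ < 1.
module Submission where

open import Defs
open import Data.Nat as ℕ using (ℕ; zero; suc; _^_; _≤_; _∸_; NonZero)
import Data.Nat.Properties as ℕP
open import Data.Nat.Divisibility using (_∣_)
open import Data.Integer as ℤ using (ℤ; +_; -[1+_])
import Data.Integer.Properties as ℤP
open import Data.Integer.Solver using (module +-*-Solver)
open import Data.Rational as ℚ using (ℚ; _/_; 0ℚ; 1ℚ; toℚᵘ)
import Data.Rational.Properties as ℚP
import Data.Rational.Unnormalised as ℚᵘ
import Data.Rational.Unnormalised.Properties as ℚᵘP
open import Data.Fin using (Fin; zero; suc; toℕ; inject₁)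
import Data.Fin as Fin
import Data.Fin.Properties as FinP
open import Data.Fin.Induction using (<-weakInduction)
open import Data.Product using (Σ; _×_; _,_)
open import Data.Sum using (inj₁; inj₂)
open import Data.Empty using (⊥-elim)
open import Relation.Nullary using (¬_)
open import Relation.Binary.PropositionalEquality

private
  variable
    n k : ℕ

-- a / suc d computes to fromℚᵘ (mkℚᵘ a d), so facts about _/_ reduce to ℚᵘ.
/-cross : ∀ a b d e .{{_ : NonZero d}} .{{_ : NonZero e}} →
          a ℤ.* + e ≡ b ℤ.* + d → a / d ≡ b / e
/-cross a b (suc d) (suc e) eq = ℚP.fromℚᵘ-cong {ℚᵘ.mkℚᵘ a d} {ℚᵘ.mkℚᵘ b e} (ℚᵘ.*≡* eq)

/-+ : ∀ u v d .{{_ : NonZero d}} → u / d ℚ.+ v / d ≡ (u ℤ.+ v) / d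
/-+ u v (suc d) = ℚP.toℚᵘ-injective (begin
  toℚᵘ (u / suc d ℚ.+ v / suc d)           ≈⟨ ℚP.toℚᵘ-homo-+ (u / suc d) (v / suc d) ⟩
  toℚᵘ (u / suc d) ℚᵘ.+ toℚᵘ (v / suc d)   ≈⟨ ℚᵘP.+-cong (ℚP.toℚᵘ-fromℚᵘ (ℚᵘ.mkℚᵘ u d))
                                                           (ℚP.toℚᵘ-fromℚᵘ (ℚᵘ.mkℚᵘ v d)) ⟩
  ℚᵘ.mkℚᵘ u d ℚᵘ.+ ℚᵘ.mkℚᵘ v d             ≈⟨ ℚᵘ.*≡* (common-denominator u v (+ suc d)) ⟩
  ℚᵘ.mkℚᵘ (u ℤ.+ v) d                      ≈⟨ ℚP.toℚᵘ-fromℚᵘ (ℚᵘ.mkℚᵘ (u ℤ.+ v) d) ⟨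
  toℚᵘ ((u ℤ.+ v) / suc d)                 ∎)
  where
  open ℚᵘP.≃-Reasoning
  open +-*-Solver
  common-denominator : ∀ u v s → (u ℤ.* s ℤ.+ v ℤ.* s) ℤ.* s ≡ (u ℤ.+ v) ℤ.* (s ℤ.* s)
  common-denominator = solve 3 (λ u v s → (u :* s :+ v :* s) :* s := (u :+ v) :* (s :* s)) refl

/-mono-≤ : ∀ a b d .{{_ : NonZero d}} → a ℤ.≤ b → a / d ℚ.≤ b / d
/-mono-≤ a b (suc d) a≤b = ℚP.toℚᵘ-cancel-≤
  (ℚᵘP.≤-respˡ-≃ (ℚᵘP.≃-sym (ℚP.toℚᵘ-fromℚᵘ (ℚᵘ.mkℚᵘ a d)))
  (ℚᵘP.≤-respʳ-≃ (ℚᵘP.≃-sym (ℚP.toℚᵘ-fromℚᵘ (ℚᵘ.mkℚᵘ b d)))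
   (ℚᵘ.*≤* (ℤP.*-monoʳ-≤-nonNeg (+ suc d) a≤b))))

/-mono-< : ∀ a b d .{{_ : NonZero d}} → a ℤ.< b → a / d ℚ.< b / d
/-mono-< a b (suc d) a<b = ℚP.toℚᵘ-cancel-<
  (ℚᵘP.<-respˡ-≃ (ℚᵘP.≃-sym (ℚP.toℚᵘ-fromℚᵘ (ℚᵘ.mkℚᵘ a d)))
  (ℚᵘP.<-respʳ-≃ (ℚᵘP.≃-sym (ℚP.toℚᵘ-fromℚᵘ (ℚᵘ.mkℚᵘ b d)))
   (ℚᵘ.*<* (ℤP.*-monoʳ-<-pos (+ suc d) a<b))))

/2^-+ : ∀ u v k → u /2^ k ℚ.+ v /2^ k ≡ (u ℤ.+ v) /2^ k
/2^-+ u v k = /-+ u v (2 ^ k) {{ℕP.m^n≢0 2 k}}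

/2^-double : ∀ z k → z /2^ k ≡ (z ℤ.* + 2) /2^ suc k
/2^-double z k =
  /-cross z (z ℤ.* + 2) (2 ^ k) (2 ^ suc k) {{ℕP.m^n≢0 2 k}} {{ℕP.m^n≢0 2 (suc k)}}
  (trans (cong (z ℤ.*_) (ℤP.pos-* 2 (2 ^ k))) (sym (ℤP.*-assoc z (+ 2) (+ (2 ^ k)))))

/2^-adjacent : ∀ x y k → x /2^ k ℚ.+ y /2^ suc k ≡ (x ℤ.* + 2 ℤ.+ y) /2^ suc k
/2^-adjacent x y k = trans (cong (ℚ._+ y /2^ suc k) (/2^-double x k)) (/2^-+ (x ℤ.* + 2) y (suc k))

/2^-mono-≤ : ∀ {a b} k → a ℤ.≤ b → a /2^ k ℚ.≤ b /2^ k
/2^-mono-≤ {a} {b} k = /-mono-≤ a b (2 ^ k) {{ℕP.m^n≢0 2 k}}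

/2^-<1 : ∀ {m} k → m ℕ.< 2 ^ k → (+ m) /2^ k ℚ.< 1ℚ
/2^-<1 {m} k m<2^k = subst ((+ m) /2^ k ℚ.<_) 2^k/2^k≡1
  (/-mono-< (+ m) (+ (2 ^ k)) (2 ^ k) {{ℕP.m^n≢0 2 k}} (ℤ.+<+ m<2^k))
  where
  2^k/2^k≡1 : (+ (2 ^ k)) /2^ k ≡ 1ℚ
  2^k/2^k≡1 = /-cross (+ (2 ^ k)) (+ 1) (2 ^ k) 1 {{ℕP.m^n≢0 2 k}} (ℤP.*-comm (+ (2 ^ k)) (+ 1))

Σ[<]-cong : ∀ {f g : Fin k → ℚ} → (∀ i → f i ≡ g i) → Σ[<] k f ≡ Σ[<] k g
Σ[<]-cong {zero}  f≗g = refl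
Σ[<]-cong {suc k} f≗g = cong₂ ℚ._+_ (f≗g zero) (Σ[<]-cong (λ i → f≗g (suc i)))

setPair : (Fin (suc n) → ℤ) → Fin n → ℤ → ℤ → Fin (suc n) → ℤ
setPair A zero    x y zero          = x
setPair A zero    x y (suc zero)    = y
setPair A zero    x y (suc (suc i)) = A (suc (suc i))
setPair A (suc j) x y zero          = A zero
setPair A (suc j) x y (suc i)       = setPair (λ i → A (suc i)) j x y i

setPair-suc : ∀ (A : Fin (suc n) → ℤ) j x y → setPair A j x y (suc j) ≡ y
setPair-suc A zero    x y = refl
setPair-suc A (suc j) x y = setPair-suc (λ i → A (suc i)) j x y

setPair-above : ∀ (A : Fin (suc n) → ℤ) j x y i → suc j Fin.< i → setPair A j x y i ≡ A i
setPair-above A zero    x y (suc zero)    (ℕ.s≤s ())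
setPair-above A zero    x y (suc (suc i)) _           = refl
setPair-above A (suc j) x y (suc i)       (ℕ.s≤s j<i) = setPair-above (λ i → A (suc i)) j x y i j<i

setPair-preserves : ∀ (P : Fin (suc n) → ℤ → Set) {A} j {x y} →
                    (∀ i → P i (A i)) → P (inject₁ j) x → P (suc j) y →
                    ∀ i → P i (setPair A j x y i)
setPair-preserves P zero    pA px py zero          = px
setPair-preserves P zero    pA px py (suc zero)    = py
setPair-preserves P zero    pA px py (suc (suc i)) = pA (suc (suc i))
setPair-preserves P (suc j) pA px py zero          = pA zero
setPair-preserves P (suc j) pA px py (suc i)       =
  setPair-preserves (λ i → P (suc i)) j (λ i → pA (suc i)) px py i

Σ[<]-setPair : ∀ (w : Fin (suc k) → ℤ → ℚ) A j x y →
               w (inject₁ j) x ℚ.+ w (suc j) y ≡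
                 w (inject₁ j) (A (inject₁ j)) ℚ.+ w (suc j) (A (suc j)) →
               Σ[<] (suc k) (λ i → w i (setPair A j x y i)) ≡ Σ[<] (suc k) (λ i → w i (A i))
Σ[<]-setPair {suc k} w A zero x y pair≡ = begin
  w zero x ℚ.+ (w (suc zero) y ℚ.+ rest)         ≡⟨ ℚP.+-assoc (w zero x) (w (suc zero) y) rest ⟨
  (w zero x ℚ.+ w (suc zero) y) ℚ.+ rest         ≡⟨ cong (ℚ._+ rest) pair≡ ⟩
  (a₀ ℚ.+ a₁) ℚ.+ rest                           ≡⟨ ℚP.+-assoc a₀ a₁ rest ⟩
  a₀ ℚ.+ (a₁ ℚ.+ rest)                           ∎
  where
  open ≡-Reasoning
  a₀ a₁ rest : ℚ
  a₀ = w zero (A zero)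
  a₁ = w (suc zero) (A (suc zero))
  rest = Σ[<] k (λ i → w (suc (suc i)) (A (suc (suc i))))
Σ[<]-setPair {suc k} w A (suc j) x y pair≡ =
  cong (w zero (A zero) ℚ.+_) (Σ[<]-setPair (λ i → w (suc i)) (λ i → A (suc i)) j x y pair≡)

value-setPair : ∀ (A : Fin (suc n) → ℤ) j x y →
                x ℤ.* + 2 ℤ.+ y ≡ A (inject₁ j) ℤ.* + 2 ℤ.+ A (suc j) →
                value n (setPair A j x y) ≡ value n A
value-setPair A j x y digits≡ = Σ[<]-setPair (λ i a → a /2^ toℕ i) A j x y (begin
  x /2^ toℕ (inject₁ j) ℚ.+ y /2^ suc (toℕ j)
    ≡⟨ adjacent x y ⟩
  (x ℤ.* + 2 ℤ.+ y) /2^ suc (toℕ j)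
    ≡⟨ cong (_/2^ suc (toℕ j)) digits≡ ⟩
  (A (inject₁ j) ℤ.* + 2 ℤ.+ A (suc j)) /2^ suc (toℕ j)
    ≡⟨ adjacent (A (inject₁ j)) (A (suc j)) ⟨
  A (inject₁ j) /2^ toℕ (inject₁ j) ℚ.+ A (suc j) /2^ suc (toℕ j)
    ∎)
  where
  open ≡-Reasoning
  adjacent : ∀ x y → x /2^ toℕ (inject₁ j) ℚ.+ y /2^ suc (toℕ j) ≡ (x ℤ.* + 2 ℤ.+ y) /2^ suc (toℕ j)
  adjacent x y = trans (cong (λ e → x /2^ e ℚ.+ y /2^ suc (toℕ j)) (FinP.toℕ-inject₁ j))
                       (/2^-adjacent x y (toℕ j))

IsDigit : Fin (suc n) → ℤ → Set
IsDigit zero    = IsBit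
IsDigit (suc _) = IsTrit

IsBit⇒IsDigit : ∀ (i : Fin (suc n)) {x} → IsBit x → IsDigit i x
IsBit⇒IsDigit zero    x-bit = x-bit
IsBit⇒IsDigit (suc i) x-bit = inj₂ x-bit

IsTrit⇒≥-1 : ∀ {t} → IsTrit t → -[1+ 0 ] ℤ.≤ t
IsTrit⇒≥-1 (inj₁ refl)        = ℤP.≤-refl
IsTrit⇒≥-1 (inj₂ (inj₁ refl)) = ℤ.-≤+
IsTrit⇒≥-1 (inj₂ (inj₂ refl)) = ℤ.-≤+

Σ[<]-≥-1-lower-bound : ∀ e (t : Fin k → ℤ) → (∀ i → -[1+ 0 ] ℤ.≤ t i) →
                       -[1+ 0 ] /2^ e ℚ.≤ Σ[<] k (λ i → t i /2^ suc (toℕ i ℕ.+ e))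
Σ[<]-≥-1-lower-bound {zero} e t t≥-1 =
  subst (-[1+ 0 ] /2^ e ℚ.≤_) (ℚP.0/n≡0 (2 ^ e) {{ℕP.m^n≢0 2 e}}) (/2^-mono-≤ {b = + 0} e ℤ.-≤+)
Σ[<]-≥-1-lower-bound {suc k} e t t≥-1 = begin
  -[1+ 0 ] /2^ e
    ≡⟨ halves ⟩
  -[1+ 0 ] /2^ suc e ℚ.+ -[1+ 0 ] /2^ suc e
    ≤⟨ ℚP.+-mono-≤ (/2^-mono-≤ (suc e) (t≥-1 zero)) tail-bound ⟩
  t zero /2^ suc e ℚ.+ tail
    ∎
  where
  open ℚP.≤-Reasoning
  tail : ℚ
  tail = Σ[<] k (λ i → t (suc i) /2^ suc (suc (toℕ i ℕ.+ e)))
  halves : -[1+ 0 ] /2^ e ≡ -[1+ 0 ] /2^ suc e ℚ.+ -[1+ 0 ] /2^ suc e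
  halves = trans (/2^-double -[1+ 0 ] e) (sym (/2^-+ -[1+ 0 ] -[1+ 0 ] (suc e)))
  tail-bound : -[1+ 0 ] /2^ suc e ℚ.≤ tail
  tail-bound = subst (-[1+ 0 ] /2^ suc e ℚ.≤_)
    (Σ[<]-cong (λ i → cong (λ d → t (suc i) /2^ suc d) (ℕP.+-suc (toℕ i) e)))
    (Σ[<]-≥-1-lower-bound (suc e) (λ i → t (suc i)) (λ i → t≥-1 (suc i)))

value-≥1 : ∀ (A : Fin (suc (suc n)) → ℤ) → (∀ i → IsDigit i (A i)) →
           A zero ≡ + 1 → A (suc zero) ≡ + 1 → 1ℚ ℚ.≤ value (suc n) A
value-≥1 {n} A digits A₀≡1 A₁≡1 = begin
  1ℚ                                        ≡⟨ ℚP.+-identityʳ 1ℚ ⟨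
  1ℚ ℚ.+ 0ℚ                                 ≡⟨ cong (1ℚ ℚ.+_) (ℚP.+-inverseʳ ½) ⟨
  1ℚ ℚ.+ (½ ℚ.+ -[1+ 0 ] /2^ 1)             ≤⟨ ℚP.+-monoʳ-≤ 1ℚ (ℚP.+-monoʳ-≤ ½ tail-bound) ⟩
  1ℚ ℚ.+ (½ ℚ.+ tail)                       ≡⟨ cong₂ (λ a b → a /2^ 0 ℚ.+ (b /2^ 1 ℚ.+ tail))
                                                       A₀≡1 A₁≡1 ⟨
  value (suc n) A                           ∎
  where
  open ℚP.≤-Reasoning
  ½ tail : ℚ
  ½ = (+ 1) /2^ 1
  tail = Σ[<] n (λ i → A (suc (suc i)) /2^ suc (suc (toℕ i)))
  tail-bound : -[1+ 0 ] /2^ 1 ℚ.≤ tail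
  tail-bound = subst (-[1+ 0 ] /2^ 1 ℚ.≤_)
    (Σ[<]-cong (λ i → cong (λ d → A (suc (suc i)) /2^ suc d) (ℕP.+-comm (toℕ i) 1)))
    (Σ[<]-≥-1-lower-bound 1 (λ i → A (suc (suc i))) (λ i → IsTrit⇒≥-1 (digits (suc (suc i)))))

record Recoding (A : Fin (suc n) → ℤ) (j : Fin n) : Set where
  field
    code         : Fin (suc n) → ℤ
    code-digits  : ∀ i → IsDigit i (code i)
    value-code   : value n code ≡ value n A
    code-at-j    : code (suc j) ≡ -[1+ 0 ]
    code-above-j : ∀ i → suc j Fin.< i → code i ≡ A i

open Recoding

Recoding-trans : ∀ {A : Fin (suc n) → ℤ} {i j} (R : Recoding A i) →
                 Recoding (code R) j → i Fin.< j → Recoding A j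
Recoding-trans R S i<j = record
  { code         = code S
  ; code-digits  = code-digits S
  ; value-code   = trans (value-code S) (value-code R)
  ; code-at-j    = code-at-j S
  ; code-above-j = λ l j<l → trans (code-above-j S l j<l)
                                   (code-above-j R l (ℕP.<-trans (ℕ.s≤s i<j) j<l))
  }

carry : ∀ {A : Fin (suc n) → ℤ} → (∀ i → IsDigit i (A i)) → ∀ j {a} →
        A (inject₁ j) ≡ a → A (suc j) ≡ + 1 → IsBit (a ℤ.+ + 1) → Recoding A j
carry {A = A} digits j {a} A[j-1]≡a A[j]≡1 a+1-bit = record
  { code         = setPair A j (a ℤ.+ + 1) -[1+ 0 ]
  ; code-digits  = setPair-preserves IsDigit j digits
                     (IsBit⇒IsDigit (inject₁ j) a+1-bit) (inj₁ refl)
  ; value-code   = value-setPair A j (a ℤ.+ + 1) -[1+ 0 ] (begin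
      (a ℤ.+ + 1) ℤ.* + 2 ℤ.+ -[1+ 0 ]       ≡⟨ carry-identity a ⟩
      a ℤ.* + 2 ℤ.+ + 1                      ≡⟨ cong₂ (λ a b → a ℤ.* + 2 ℤ.+ b) A[j-1]≡a A[j]≡1 ⟨
      A (inject₁ j) ℤ.* + 2 ℤ.+ A (suc j)    ∎)
  ; code-at-j    = setPair-suc A j (a ℤ.+ + 1) -[1+ 0 ]
  ; code-above-j = setPair-above A j (a ℤ.+ + 1) -[1+ 0 ]
  }
  where
  open ≡-Reasoning
  open +-*-Solver
  carry-identity : ∀ a → (a ℤ.+ + 1) ℤ.* + 2 ℤ.+ -[1+ 0 ] ≡ a ℤ.* + 2 ℤ.+ + 1
  carry-identity = solve 1 (λ a → (a :+ con (+ 1)) :* con (+ 2) :+ con -[1+ 0 ]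
                               := a :* con (+ 2) :+ con (+ 1)) refl

recode : ∀ (A : Fin (suc n) → ℤ) → (∀ i → IsDigit i (A i)) → value n A ℚ.< 1ℚ →
         ∀ j → A (suc j) ≡ + 1 → Recoding A j
recode {suc n} A digits value<1 = <-weakInduction (λ j → A (suc j) ≡ + 1 → Recoding A j) first next
  where
  first : A (suc zero) ≡ + 1 → Recoding A zero
  first A₁≡1 with digits zero
  ... | inj₁ A₀≡0 = carry digits zero A₀≡0 A₁≡1 (inj₂ refl)
  ... | inj₂ A₀≡1 = ⊥-elim (ℚP.<-irrefl refl (ℚP.<-≤-trans value<1 (value-≥1 A digits A₀≡1 A₁≡1)))
  next : ∀ i → (A (suc (inject₁ i)) ≡ + 1 → Recoding A (inject₁ i)) →
         A (suc (suc i)) ≡ + 1 → Recoding A (suc i)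
  next i recode-before A[i+2]≡1 with digits (suc (inject₁ i))
  ... | inj₁ A[i+1]≡-1        = carry digits (suc i) A[i+1]≡-1 A[i+2]≡1 (inj₁ refl)
  ... | inj₂ (inj₁ A[i+1]≡0) = carry digits (suc i) A[i+1]≡0 A[i+2]≡1 (inj₂ refl)
  ... | inj₂ (inj₂ A[i+1]≡1) = Recoding-trans R
    (carry (code-digits R) (suc i) (code-at-j R) R[i+2]≡1 (inj₁ refl))
    (FinP.≤̄⇒inject₁< ℕP.≤-refl)
    where
    R : Recoding A (inject₁ i)
    R = recode-before A[i+1]≡1
    i+1<i+2 : suc (inject₁ i) Fin.< suc (suc i)
    i+1<i+2 = ℕ.s≤s (FinP.≤̄⇒inject₁< ℕP.≤-refl)
    R[i+2]≡1 : code R (suc (suc i)) ≡ + 1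
    R[i+2]≡1 = trans (code-above-j R (suc (suc i)) i+1<i+2) A[i+2]≡1

corollary2 : (n : ℕ) → 1 ≤ n → (m : ℕ) → ¬ (2 ∣ m) → 1 ≤ m → m ≤ 2 ^ n ∸ 1 →
    (A : Fin (suc n) → ℤ) → IsEXB n ((+ m) /2^ n) A →
    (j : Fin n) → A (Fin.suc j) ≡ + 1 →
    Σ (Fin (suc n) → ℤ) (λ B → IsEXB n ((+ m) /2^ n) B × B (Fin.suc j) ≡ -[1+ 0 ])
corollary2 n _ m _ _ m≤2ⁿ-1 A (A₀-bit , Aⱼ-trit , M≡value) j Aⱼ≡1 =
  code R , (code-digits R zero , (λ i → code-digits R (suc i)) , M≡value-code) , code-at-j R
  where
  digits : ∀ i → IsDigit i (A i)
  digits zero    = A₀-bit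
  digits (suc i) = Aⱼ-trit i
  M<1 : (+ m) /2^ n ℚ.< 1ℚ
  M<1 = /2^-<1 n (ℕP.≤-<-trans m≤2ⁿ-1 (ℕP.∸-monoʳ-< (ℕ.s≤s ℕ.z≤n) (ℕP.m^n>0 2 n)))
  R : Recoding A j
  R = recode A digits (subst (ℚ._< 1ℚ) M≡value M<1) j Aⱼ≡1
  M≡value-code : (+ m) /2^ n ≡ value n (code R)
  M≡value-code = trans M≡value (sym (value-code R))
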